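{- Let $P$ be a snake, that is, a parallelogram polyomino that contains no four cells forming a $2\times2$ square. Then there is exactly one Baxter slicing whose underlying polyomino is $P$.
   Context: A parallelogram polyomino is an edge-connected set of unit cells of the plane forming the interior of a contour made of two lattice paths with unit steps $(0,1)$ and $(1,0)$. The two paths meet only at their common start and at their common end. Its size is $k+\ell-1$ when its bounding rectangle is $k\times\ell$. A Baxter slicing of size $n$ is a parallelogram polyomino $P$ of size $n$ whose interior is divided into $n$ blocks, defined recursively: - for $n=1$, the single cell is the single block; - for $n\ge2$, one block is either the topmost row of $P$ (a horizontal block) or the rightmost column of $P$ (a vertical block), and the remaining $n-1$ blocks form a Baxter slicing of the polyomino obtained by deleting that row, respectively that column. -}

module Defs where

open import Data.Nat using (ℕ; zero; suc; _+_; _∸_; _≤_; _<_; _⊔_)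
open import Data.Nat.Properties using (_≟_)
open import Data.Product using (Σ; _×_; _,_; proj₁; proj₂)
open import Data.Sum using (_⊎_)
open import Data.List using (List; []; _∷_; map; foldr; filter)
open import Data.Maybe using (Maybe; just; nothing)
open import Data.List.Membership.Propositional using (_∈_)
open import Relation.Nullary using (¬_)
open import Relation.Nullary.Decidable using (¬?)
open import Relation.Binary.PropositionalEquality using (_≡_)

data Step : Set where
  N E : Step

-- A cell is identified with the coordinates (x , y) of its lower-left corner.
Cell : Set
Cell = ℕ × ℕ

Point : Set
Point = ℕ × ℕ

countN : List Step → ℕ
countN []      = 0
countN (N ∷ s) = suc (countN s)
countN (E ∷ s) = countN s

countE : List Step → ℕ
countE []      = 0
countE (N ∷ s) = countE s
countE (E ∷ s) = suc (countE s)

vertices : Point → List Step → List Point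
vertices p       []      = p ∷ []
vertices (x , y) (N ∷ s) = (x , y) ∷ vertices (x , suc y) s
vertices (x , y) (E ∷ s) = (x , y) ∷ vertices (suc x , y) s

-- For each east step of a path (in order), the height (relative to the
-- start) at which that step is taken.
eastHeights : List Step → List ℕ
eastHeights []      = []
eastHeights (N ∷ s) = map suc (eastHeights s)
eastHeights (E ∷ s) = 0 ∷ eastHeights s

nth : {A : Set} → List A → ℕ → Maybe A
nth []       _       = nothing
nth (a ∷ _)  zero    = just a
nth (_ ∷ as) (suc i) = nth as i

record Contour : Set where
  constructor contour
  field
    start : Point
    upper : List Step
    lower : List Step

open Contour public

endPoint : Contour → Point
endPoint c = (proj₁ (start c) + countE (upper c) , proj₂ (start c) + countN (upper c))

StartsWith : Step → List Step → Set
StartsWith d s = Σ (List Step) λ t → s ≡ d ∷ t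

record IsPPContour (c : Contour) : Set where
  field
    upperStartsN : StartsWith N (upper c)
    lowerStartsE : StartsWith E (lower c)
    sameE        : countE (upper c) ≡ countE (lower c)
    sameN        : countN (upper c) ≡ countN (lower c)
    meetOnlyEnds : ∀ p → p ∈ vertices (start c) (upper c) → p ∈ vertices (start c) (lower c)
                   → p ≡ start c ⊎ p ≡ endPoint c

-- Cell (x , y) lies in the interior of the contour: it is in column i
-- (x = x₀ + i), above the lower path and below the upper path there.
InInterior : Contour → Cell → Set
InInterior c (x , y) =
  Σ ℕ λ i → Σ ℕ λ hl → Σ ℕ λ hu →
    (x ≡ proj₁ (start c) + i) ×
    (nth (eastHeights (lower c)) i ≡ just hl) ×
    (nth (eastHeights (upper c)) i ≡ just hu) ×
    (proj₂ (start c) + hl ≤ y) × (y < proj₂ (start c) + hu)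

-- Size k + ℓ - 1 of a polyomino with k × ℓ bounding rectangle.
contourSize : Contour → ℕ
contourSize c = countE (upper c) + countN (upper c) ∸ 1

IsParallelogramPolyomino : ℕ → List Cell → Set
IsParallelogramPolyomino n R =
  Σ Contour λ c → IsPPContour c × (contourSize c ≡ n) ×
    ((∀ z → z ∈ R → InInterior c z) × (∀ z → InInterior c z → z ∈ R))

Snake : List Cell → Set
Snake R = ∀ x y → ¬ (((x , y) ∈ R) × ((suc x , y) ∈ R) × ((x , suc y) ∈ R) × ((suc x , suc y) ∈ R))

maxY : List Cell → ℕ
maxY R = foldr _⊔_ 0 (map proj₂ R)

maxX : List Cell → ℕ
maxX R = foldr _⊔_ 0 (map proj₁ R)

topRow : List Cell → List Cell
topRow R = filter (λ z → proj₂ z ≟ maxY R) R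

deleteTopRow : List Cell → List Cell
deleteTopRow R = filter (λ z → ¬? (proj₂ z ≟ maxY R)) R

rightColumn : List Cell → List Cell
rightColumn R = filter (λ z → proj₁ z ≟ maxX R) R

deleteRightColumn : List Cell → List Cell
deleteRightColumn R = filter (λ z → ¬? (proj₁ z ≟ maxX R)) R

-- Baxter slicings: BaxterSlicing n R bs means that the list of blocks bs
-- (first the block removed first, ...) is a Baxter slicing of size n of
-- the parallelogram polyomino R.

data BaxterSlicing : ℕ → List Cell → List (List Cell) → Set where
  single : ∀ R → IsParallelogramPolyomino 1 R → BaxterSlicing 1 R (R ∷ [])
  horiz  : ∀ n R bs → IsParallelogramPolyomino (suc n) R →
           BaxterSlicing n (deleteTopRow R) bs →
           BaxterSlicing (suc n) R (topRow R ∷ bs)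
  vert   : ∀ n R bs → IsParallelogramPolyomino (suc n) R →
           BaxterSlicing n (deleteRightColumn R) bs →
           BaxterSlicing (suc n) R (rightColumn R ∷ bs)

-- The upper path of a parallelogram polyomino ends with an east step and the lower one with a
-- north step, so its top-right corner is determined by the step before these. Upper …NE with
-- lower …EN makes the paths meet before their end, which only a single cell allows; upper …EE
-- with lower …NN puts a 2 × 2 square into the corner, which a snake forbids. In the two remaining
-- corners, …NE/…NN and …EE/…EN, one of the top row and the right column is the single top-right
-- cell. Deleting that block leaves a parallelogram polyomino of size one less; deleting the other
-- block removes the top row and the right column together, leaving cells in a rectangle whose
-- semi-perimeter is too small for that size. So at each stage exactly one slicing move is
-- possible, and the Baxter slicing is unique by induction.

module Submission where

open import Defs
open import Data.Nat using (ℕ; zero; suc; _+_; _∸_; _≤_; _<_; _⊔_; z≤n; s≤s; _≤?_)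
open import Data.Nat.Properties
open import Data.Nat.Tactic.RingSolver using (solve-∀)
open import Data.Product using (Σ; ∃; ∃₂; _×_; _,_; proj₁; proj₂)
open import Data.Sum using (_⊎_; inj₁; inj₂)
open import Data.List using (List; []; _∷_; map; foldr; filter; _++_; _∷ʳ_; length)
open import Data.List.Properties using (map-++; length-map)
open import Data.List.Reverse using ([]; _∶_∶ʳ_; reverseView)
open import Data.List.Membership.Propositional using (_∈_)
open import Data.List.Membership.Propositional.Properties using (∈-filter⁺; ∈-filter⁻)
open import Data.List.Relation.Unary.Any using (here; there)
open import Data.Maybe using (just)
open import Data.Empty using (⊥-elim)
open import Relation.Nullary using (¬_; Dec; yes; no)
open import Relation.Nullary.Decidable using (¬?)
open import Relation.Binary.PropositionalEquality

open IsPPContour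

<+suc∧≢⇒< : ∀ {a} y c → a < y + suc c → a ≢ y + c → a < y + c
<+suc∧≢⇒< {a} y c lt ne = ≤∧≢⇒< (m<1+n⇒m≤n (subst (a <_) (+-suc y c) lt)) ne

countE-∷ʳE : ∀ s → countE (s ∷ʳ E) ≡ suc (countE s)
countE-∷ʳE []      = refl
countE-∷ʳE (N ∷ s) = countE-∷ʳE s
countE-∷ʳE (E ∷ s) = cong suc (countE-∷ʳE s)

countE-∷ʳN : ∀ s → countE (s ∷ʳ N) ≡ countE s
countE-∷ʳN []      = refl
countE-∷ʳN (N ∷ s) = countE-∷ʳN s
countE-∷ʳN (E ∷ s) = cong suc (countE-∷ʳN s)

countN-∷ʳN : ∀ s → countN (s ∷ʳ N) ≡ suc (countN s)
countN-∷ʳN []      = refl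
countN-∷ʳN (N ∷ s) = cong suc (countN-∷ʳN s)
countN-∷ʳN (E ∷ s) = countN-∷ʳN s

countN-∷ʳE : ∀ s → countN (s ∷ʳ E) ≡ countN s
countN-∷ʳE []      = refl
countN-∷ʳE (N ∷ s) = cong suc (countN-∷ʳE s)
countN-∷ʳE (E ∷ s) = countN-∷ʳE s

eastHeights-∷ʳN : ∀ s → eastHeights (s ∷ʳ N) ≡ eastHeights s
eastHeights-∷ʳN []      = refl
eastHeights-∷ʳN (N ∷ s) = cong (map suc) (eastHeights-∷ʳN s)
eastHeights-∷ʳN (E ∷ s) = cong (0 ∷_) (eastHeights-∷ʳN s)

eastHeights-∷ʳE : ∀ s → eastHeights (s ∷ʳ E) ≡ eastHeights s ∷ʳ countN s
eastHeights-∷ʳE []      = refl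
eastHeights-∷ʳE (N ∷ s) = trans (cong (map suc) (eastHeights-∷ʳE s)) (map-++ suc (eastHeights s) _)
eastHeights-∷ʳE (E ∷ s) = cong (0 ∷_) (eastHeights-∷ʳE s)

length-eastHeights : ∀ s → length (eastHeights s) ≡ countE s
length-eastHeights []      = refl
length-eastHeights (N ∷ s) = trans (length-map suc (eastHeights s)) (length-eastHeights s)
length-eastHeights (E ∷ s) = cong suc (length-eastHeights s)

¬StartsWith[] : ∀ {d} → ¬ StartsWith d []
¬StartsWith[] (_ , ())

StartsWith⇒countE>0 : ∀ {s} → StartsWith E s → 0 < countE s
StartsWith⇒countE>0 (_ , refl) = s≤s z≤n

StartsWith⇒countN>0 : ∀ {s} → StartsWith N s → 0 < countN s
StartsWith⇒countN>0 (_ , refl) = s≤s z≤n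

StartsWith-dropLast : ∀ {d e e′} s → StartsWith d (s ∷ʳ e ∷ʳ e′) → StartsWith d (s ∷ʳ e)
StartsWith-dropLast []      (_ , refl) = [] , refl
StartsWith-dropLast (_ ∷ s) (_ , refl) = s ∷ʳ _ , refl

StartsWith-replaceLast : ∀ {d e e′} s → s ≢ [] → StartsWith d (s ∷ʳ e) → StartsWith d (s ∷ʳ e′)
StartsWith-replaceLast []      s≢[] _          = ⊥-elim (s≢[] refl)
StartsWith-replaceLast (_ ∷ s) _    (_ , refl) = s ∷ʳ _ , refl

countN≡suc⇒≢[] : ∀ {s k} → countN s ≡ suc k → s ≢ []
countN≡suc⇒≢[] e refl = 0≢1+n e

countE≡suc⇒≢[] : ∀ {s k} → countE s ≡ suc k → s ≢ []
countE≡suc⇒≢[] e refl = 0≢1+n e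

module _ {A : Set} where

  nth-∷ʳ⁻ : ∀ (l : List A) {a b} i → nth (l ∷ʳ a) i ≡ just b → nth l i ≡ just b ⊎ (i ≡ length l × b ≡ a)
  nth-∷ʳ⁻ []      zero    refl = inj₂ (refl , refl)
  nth-∷ʳ⁻ (x ∷ l) zero    eq   = inj₁ eq
  nth-∷ʳ⁻ (x ∷ l) (suc i) eq with nth-∷ʳ⁻ l i eq
  ... | inj₁ e        = inj₁ e
  ... | inj₂ (e , e′) = inj₂ (cong suc e , e′)

  nth-∷ʳ⁺ : ∀ (l : List A) {a b} i → nth l i ≡ just b → nth (l ∷ʳ a) i ≡ just b
  nth-∷ʳ⁺ (x ∷ l) zero    eq = eq
  nth-∷ʳ⁺ (x ∷ l) (suc i) eq = nth-∷ʳ⁺ l i eq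

  nth-∷ʳ-length : ∀ (l : List A) a → nth (l ∷ʳ a) (length l) ≡ just a
  nth-∷ʳ-length []      a = refl
  nth-∷ʳ-length (x ∷ l) a = nth-∷ʳ-length l a

  nth-just⇒<length : ∀ (l : List A) i {a} → nth l i ≡ just a → i < length l
  nth-just⇒<length (x ∷ l) zero    eq = s≤s z≤n
  nth-just⇒<length (x ∷ l) (suc i) eq = s≤s (nth-just⇒<length l i eq)

  <length⇒nth-just : ∀ (l : List A) i → i < length l → ∃ λ a → nth l i ≡ just a
  <length⇒nth-just (x ∷ l) zero    _         = x , refl
  <length⇒nth-just (x ∷ l) (suc i) (s≤s i<l) = <length⇒nth-just l i i<l

  nth-resp : ∀ {l l′ : List A} i {a} → l ≡ l′ → nth l i ≡ just a → nth l′ i ≡ just a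
  nth-resp i refl e = e

  nth-just-pred : ∀ (l : List A) i {a} → nth l (suc i) ≡ just a → ∃ λ b → nth l i ≡ just b
  nth-just-pred l i e = <length⇒nth-just l i (<⇒≤ (nth-just⇒<length l (suc i) e))

module _ {A B : Set} (f : A → B) where

  nth-map⁻ : ∀ l i {b} → nth (map f l) i ≡ just b → ∃ λ a → nth l i ≡ just a × f a ≡ b
  nth-map⁻ (x ∷ l) zero    refl = x , refl , refl
  nth-map⁻ (x ∷ l) (suc i) eq   = nth-map⁻ l i eq

  nth-map⁺ : ∀ l i {a} → nth l i ≡ just a → nth (map f l) i ≡ just (f a)
  nth-map⁺ (x ∷ l) zero    refl = refl
  nth-map⁺ (x ∷ l) (suc i) eq   = nth-map⁺ l i eq

eastHeight≤countN : ∀ s i {h} → nth (eastHeights s) i ≡ just h → h ≤ countN s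
eastHeight≤countN (N ∷ s) i eq with nth-map⁻ suc (eastHeights s) i eq
... | h , e , refl = s≤s (eastHeight≤countN s i e)
eastHeight≤countN (E ∷ s) zero    refl = z≤n
eastHeight≤countN (E ∷ s) (suc i) eq   = eastHeight≤countN s i eq

eastHeight-mono : ∀ s i {a b} → nth (eastHeights s) i ≡ just a → nth (eastHeights s) (suc i) ≡ just b → a ≤ b
eastHeight-mono (N ∷ s) i ea eb with nth-map⁻ suc (eastHeights s) i ea | nth-map⁻ suc (eastHeights s) (suc i) eb
... | _ , e , refl | _ , e′ , refl = s≤s (eastHeight-mono s i e e′)
eastHeight-mono (E ∷ s) zero    refl eb = z≤n
eastHeight-mono (E ∷ s) (suc i) ea   eb = eastHeight-mono s i ea eb

eastHeight⇒<countE : ∀ s i {h} → nth (eastHeights s) i ≡ just h → i < countE s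
eastHeight⇒<countE s i e = subst (i <_) (length-eastHeights s) (nth-just⇒<length (eastHeights s) i e)

<countE⇒eastHeight : ∀ s i → i < countE s → ∃ λ h → nth (eastHeights s) i ≡ just h × h ≤ countN s
<countE⇒eastHeight s i lt with <length⇒nth-just (eastHeights s) i (subst (i <_) (sym (length-eastHeights s)) lt)
... | h , e = h , e , eastHeight≤countN s i e

eastHeight-last : ∀ s → nth (eastHeights (s ∷ʳ E)) (countE s) ≡ just (countN s)
eastHeight-last s = begin
  nth (eastHeights (s ∷ʳ E)) (countE s)         ≡⟨ cong (λ l → nth l (countE s)) (eastHeights-∷ʳE s) ⟩
  nth (eastHeights s ∷ʳ countN s) (countE s)    ≡⟨ cong (nth (eastHeights s ∷ʳ countN s)) (sym (length-eastHeights s)) ⟩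
  nth (eastHeights s ∷ʳ countN s) (length (eastHeights s)) ≡⟨ nth-∷ʳ-length (eastHeights s) (countN s) ⟩
  just (countN s)                               ∎
  where open ≡-Reasoning

∈-resp-≡ : ∀ {p q : Point} {l} → p ≡ q → p ∈ l → q ∈ l
∈-resp-≡ refl p∈ = p∈

pathEnd : Point → List Step → Point
pathEnd (x , y) s = (x + countE s , y + countN s)

start∈vertices : ∀ p s → p ∈ vertices p s
start∈vertices p       []      = here refl
start∈vertices (x , y) (N ∷ s) = here refl
start∈vertices (x , y) (E ∷ s) = here refl

pathEnd∈vertices : ∀ x y s → pathEnd (x , y) s ∈ vertices (x , y) s
pathEnd∈vertices x y []      = here (cong₂ _,_ (+-identityʳ x) (+-identityʳ y))
pathEnd∈vertices x y (N ∷ s) =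
  there (∈-resp-≡ (cong (x + countE s ,_) (sym (+-suc y (countN s)))) (pathEnd∈vertices x (suc y) s))
pathEnd∈vertices x y (E ∷ s) =
  there (∈-resp-≡ (cong (_, y + countN s) (sym (+-suc x (countE s)))) (pathEnd∈vertices (suc x) y s))

vertices-++⁺ : ∀ p s t {q} → q ∈ vertices p s → q ∈ vertices p (s ++ t)
vertices-++⁺ p       []      t (here refl) = start∈vertices p t
vertices-++⁺ (x , y) (N ∷ s) t (here e)    = here e
vertices-++⁺ (x , y) (N ∷ s) t (there q∈)  = there (vertices-++⁺ (x , suc y) s t q∈)
vertices-++⁺ (x , y) (E ∷ s) t (here e)    = here e
vertices-++⁺ (x , y) (E ∷ s) t (there q∈)  = there (vertices-++⁺ (suc x , y) s t q∈)

vertices-∷ʳ⁻ : ∀ p s d {q} → q ∈ vertices p (s ∷ʳ d) → q ∈ vertices p s ⊎ q ≡ pathEnd p (s ∷ʳ d)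
vertices-∷ʳ⁻ (x , y) []      N (here e)           = inj₁ (here e)
vertices-∷ʳ⁻ (x , y) []      N (there (here refl)) = inj₂ (cong₂ _,_ (sym (+-identityʳ x)) (sym (+-comm y 1)))
vertices-∷ʳ⁻ (x , y) []      E (here e)           = inj₁ (here e)
vertices-∷ʳ⁻ (x , y) []      E (there (here refl)) = inj₂ (cong₂ _,_ (sym (+-comm x 1)) (sym (+-identityʳ y)))
vertices-∷ʳ⁻ (x , y) (N ∷ s) d (here e)           = inj₁ (here e)
vertices-∷ʳ⁻ (x , y) (N ∷ s) d (there q∈) with vertices-∷ʳ⁻ (x , suc y) s d q∈
... | inj₁ q∈′ = inj₁ (there q∈′)
... | inj₂ e   = inj₂ (trans e (cong (x + countE (s ∷ʳ d) ,_) (sym (+-suc y _))))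
vertices-∷ʳ⁻ (x , y) (E ∷ s) d (here e)           = inj₁ (here e)
vertices-∷ʳ⁻ (x , y) (E ∷ s) d (there q∈) with vertices-∷ʳ⁻ (suc x , y) s d q∈
... | inj₁ q∈′ = inj₁ (there q∈′)
... | inj₂ e   = inj₂ (trans e (cong (_, y + countN (s ∷ʳ d)) (sym (+-suc x _))))

vertices-bounded : ∀ x y s {p} → p ∈ vertices (x , y) s → proj₁ p ≤ x + countE s × proj₂ p ≤ y + countN s
vertices-bounded x y []      (here refl) = m≤m+n x 0 , m≤m+n y 0
vertices-bounded x y (N ∷ s) (here refl) = m≤m+n x _ , m≤m+n y _
vertices-bounded x y (N ∷ s) {p} (there p∈) with vertices-bounded x (suc y) s p∈
... | px , py = px , subst (proj₂ p ≤_) (sym (+-suc y _)) py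
vertices-bounded x y (E ∷ s) (here refl) = m≤m+n x _ , m≤m+n y _
vertices-bounded x y (E ∷ s) {p} (there p∈) with vertices-bounded (suc x) y s p∈
... | px , py = subst (proj₁ p ≤_) (sym (+-suc x _)) px , py

eastStepEnd∈vertices : ∀ x y s i {h} → nth (eastHeights s) i ≡ just h → (x + suc i , y + h) ∈ vertices (x , y) s
eastStepEnd∈vertices x y (N ∷ s) i eq with nth-map⁻ suc (eastHeights s) i eq
... | h , e , refl =
  there (∈-resp-≡ (cong (x + suc i ,_) (sym (+-suc y h))) (eastStepEnd∈vertices x (suc y) s i e))
eastStepEnd∈vertices x y (E ∷ s) zero refl =
  there (∈-resp-≡ (cong₂ _,_ (+-comm 1 x) (sym (+-identityʳ y))) (start∈vertices (suc x , y) s))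
eastStepEnd∈vertices x y (E ∷ s) (suc i) {h} eq =
  there (∈-resp-≡ (cong (_, y + h) (sym (+-suc x (suc i)))) (eastStepEnd∈vertices (suc x) y s i eq))

firstColumn∈vertices : ∀ x y s t {h} → nth (eastHeights s) 0 ≡ just h → t ≤ h → (x , y + t) ∈ vertices (x , y) s
firstColumn∈vertices x y (N ∷ s) zero    _  _ = here (cong (x ,_) (+-identityʳ y))
firstColumn∈vertices x y (N ∷ s) (suc t) eq t≤h with nth-map⁻ suc (eastHeights s) 0 eq
... | h , e , refl =
  there (∈-resp-≡ (cong (x ,_) (sym (+-suc y t))) (firstColumn∈vertices x (suc y) s t e (≤-pred t≤h)))
firstColumn∈vertices x y (E ∷ s) zero    _    _  = here (cong (x ,_) (+-identityʳ y))
firstColumn∈vertices x y (E ∷ s) (suc t) refl ()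

verticalSegment∈vertices : ∀ x y s i t {a b} → nth (eastHeights s) i ≡ just a → nth (eastHeights s) (suc i) ≡ just b →
                           a ≤ t → t ≤ b → (x + suc i , y + t) ∈ vertices (x , y) s
verticalSegment∈vertices x y (N ∷ s) i t ea eb a≤t t≤b
  with nth-map⁻ suc (eastHeights s) i ea | nth-map⁻ suc (eastHeights s) (suc i) eb
verticalSegment∈vertices x y (N ∷ s) i (suc t) ea eb a≤t t≤b | _ , e , refl | _ , e′ , refl =
  there (∈-resp-≡ (cong (x + suc i ,_) (sym (+-suc y t)))
          (verticalSegment∈vertices x (suc y) s i t e e′ (≤-pred a≤t) (≤-pred t≤b)))
verticalSegment∈vertices x y (E ∷ s) zero t refl eb _ t≤b =
  there (∈-resp-≡ (cong (_, y + t) (+-comm 1 x)) (firstColumn∈vertices (suc x) y s t eb t≤b))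
verticalSegment∈vertices x y (E ∷ s) (suc i) t ea eb a≤t t≤b =
  there (∈-resp-≡ (cong (_, y + t) (sym (+-suc x (suc i)))) (verticalSegment∈vertices (suc x) y s i t ea eb a≤t t≤b))

pathEnd-cong : ∀ p s t → countE s ≡ countE t → countN s ≡ countN t → pathEnd p s ≡ pathEnd p t
pathEnd-cong (x , y) s t eE eN = cong₂ _,_ (cong (x +_) eE) (cong (y +_) eN)

lowerHeight<upperHeight : ∀ {x0 y0 U L} → IsPPContour (contour (x0 , y0) U L) →
  ∀ i {a b} → nth (eastHeights L) i ≡ just a → nth (eastHeights U) i ≡ just b → a < b
lowerHeight<upperHeight pc zero ea eb with upperStartsN pc | lowerStartsE pc
lowerHeight<upperHeight {U = .(N ∷ t)} {.(E ∷ t′)} pc zero refl eb | t , refl | t′ , refl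
  with nth-map⁻ suc (eastHeights t) 0 eb
... | _ , _ , refl = s≤s z≤n
lowerHeight<upperHeight {x0} {y0} {U} {L} pc (suc i) {a} {b} ea eb
  with nth-just-pred (eastHeights L) i ea | nth-just-pred (eastHeights U) i eb
... | a′ , ea′ | b′ , eb′ with b′ ≤? a
... | no b′≰a = ≤-trans (≰⇒> b′≰a) (eastHeight-mono U i eb′ eb)
-- Otherwise the i-th east step of the upper path ends on the lower path, in column i + 1.
... | yes b′≤a with meetOnlyEnds pc (x0 + suc i , y0 + b′) (eastStepEnd∈vertices x0 y0 U i eb′)
                     (verticalSegment∈vertices x0 y0 L i b′ ea′ ea
                        (<⇒≤ (lowerHeight<upperHeight pc i ea′ eb′)) b′≤a)
... | inj₁ e = ⊥-elim (m+1+n≢m x0 (cong proj₁ e))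
... | inj₂ e = ⊥-elim (<-irrefl (+-cancelˡ-≡ x0 _ _ (cong proj₁ e)) (eastHeight⇒<countE U (suc i) eb))

-- In the last column the lower path would already have reached the top height.
¬lastLowerStepE : ∀ {x0 y0 U L₁} → ¬ IsPPContour (contour (x0 , y0) U (L₁ ∷ʳ E))
¬lastLowerStepE {U = U} {L₁} pc with <countE⇒eastHeight U (countE L₁) last<countE
  where
  last<countE : countE L₁ < countE U
  last<countE = subst (countE L₁ <_) (sym (trans (sameE pc) (countE-∷ʳE L₁))) (n<1+n _)
... | b , eb , b≤countN =
  <⇒≱ (lowerHeight<upperHeight pc (countE L₁) (eastHeight-last L₁) eb)
      (subst (b ≤_) (trans (sameN pc) (countN-∷ʳE L₁)) b≤countN)

-- U₁ and L₁ would end at a common point other than the start and the end.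
¬lastStepsNN : ∀ {x0 y0 U₁ L₁} → ¬ IsPPContour (contour (x0 , y0) (U₁ ∷ʳ N) (L₁ ∷ʳ N))
¬lastStepsNN {x0} {y0} {U₁} {L₁} pc
  with meetOnlyEnds pc (pathEnd (x0 , y0) U₁) (vertices-++⁺ (x0 , y0) U₁ _ (pathEnd∈vertices x0 y0 U₁))
         (∈-resp-≡ (pathEnd-cong (x0 , y0) L₁ U₁ (sym eE) (sym eN)) (vertices-++⁺ (x0 , y0) L₁ _ (pathEnd∈vertices x0 y0 L₁)))
  where
  eE : countE U₁ ≡ countE L₁
  eE = trans (sym (countE-∷ʳN U₁)) (trans (sameE pc) (countE-∷ʳN L₁))
  eN : countN U₁ ≡ countN L₁
  eN = suc-injective (trans (sym (countN-∷ʳN U₁)) (trans (sameN pc) (countN-∷ʳN L₁)))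
... | inj₁ e = <⇒≢ (StartsWith⇒countE>0 (lowerStartsE pc))
                 (sym (trans (sym (sameE pc)) (trans (countE-∷ʳN U₁)
                   (+-cancelˡ-≡ x0 _ _ (trans (cong proj₁ e) (sym (+-identityʳ x0)))))))
... | inj₂ e = 1+n≢n (+-cancelˡ-≡ y0 _ _ (sym (trans (cong proj₂ e) (cong (y0 +_) (countN-∷ʳN U₁)))))

lastSteps : ∀ {x0 y0 U L} → IsPPContour (contour (x0 , y0) U L) → ∃₂ λ U₁ L₁ → U ≡ U₁ ∷ʳ E × L ≡ L₁ ∷ʳ N
lastSteps {U = U} {L} pc with reverseView U | reverseView L
... | [] | _  = ⊥-elim (¬StartsWith[] (upperStartsN pc))
... | _  | [] = ⊥-elim (¬StartsWith[] (lowerStartsE pc))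
... | U₁ ∶ _ ∶ʳ _ | L₁ ∶ _ ∶ʳ E = ⊥-elim (¬lastLowerStepE pc)
... | U₁ ∶ _ ∶ʳ N | L₁ ∶ _ ∶ʳ N = ⊥-elim (¬lastStepsNN pc)
... | U₁ ∶ _ ∶ʳ E | L₁ ∶ _ ∶ʳ N = U₁ , L₁ , refl , refl

contourSize-∷ʳE : ∀ p U₁ L → contourSize (contour p (U₁ ∷ʳ E) L) ≡ countE U₁ + countN U₁
contourSize-∷ʳE p U₁ L = cong₂ (λ a b → a + b ∸ 1) (countE-∷ʳE U₁) (countN-∷ʳE U₁)

module _ {x0 y0 U₁ L₁} (pc : IsPPContour (contour (x0 , y0) (U₁ ∷ʳ E) (L₁ ∷ʳ N))) where

  countN-corner : countN U₁ ≡ suc (countN L₁)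
  countN-corner = trans (sym (countN-∷ʳE U₁)) (trans (sameN pc) (countN-∷ʳN L₁))

  countE-corner : countE L₁ ≡ suc (countE U₁)
  countE-corner = trans (sym (countE-∷ʳN L₁)) (trans (sym (sameE pc)) (countE-∷ʳE U₁))

  topRight∈interior : InInterior (contour (x0 , y0) (U₁ ∷ʳ E) (L₁ ∷ʳ N)) (x0 + countE U₁ , y0 + countN L₁)
  topRight∈interior with <countE⇒eastHeight L₁ (countE U₁) (subst (countE U₁ <_) (sym countE-corner) (n<1+n _))
  ... | h , eh , h≤ =
    countE U₁ , h , countN U₁ , refl , nth-resp (countE U₁) (sym (eastHeights-∷ʳN L₁)) eh ,
    eastHeight-last U₁ , +-monoʳ-≤ y0 h≤ , +-monoʳ-< y0 (subst (countN L₁ <_) (sym countN-corner) (n<1+n _))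

bottomLeft∈interior : ∀ {x0 y0 U L} → IsPPContour (contour (x0 , y0) U L) → InInterior (contour (x0 , y0) U L) (x0 , y0)
bottomLeft∈interior pc with upperStartsN pc | lowerStartsE pc
bottomLeft∈interior {x0} {y0} {.(N ∷ t)} {.(E ∷ t′)} pc | t , refl | t′ , refl
  with <countE⇒eastHeight t 0 (subst (0 <_) (sym (sameE pc)) (s≤s z≤n))
... | h , eh , _ =
  0 , 0 , suc h , sym (+-identityʳ x0) , refl , nth-map⁺ suc (eastHeights t) 0 eh ,
  ≤-reflexive (+-identityʳ y0) , subst (_< y0 + suc h) (+-identityʳ y0) (+-monoʳ-< y0 (s≤s z≤n))

InRectangle : ℕ → ℕ → ℕ → ℕ → Cell → Set
InRectangle x y width height (cx , cy) = x ≤ cx × y ≤ cy × cx < x + width × cy < y + height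

interior⊆rectangle : ∀ {x0 y0} U L z → InInterior (contour (x0 , y0) U L) z → InRectangle x0 y0 (countE U) (countN U) z
interior⊆rectangle {x0} {y0} U L (x , y) (i , hl , hu , refl , ehl , ehu , hl≤ , <hu) =
  m≤m+n x0 i , ≤-trans (m≤m+n y0 hl) hl≤ , +-monoʳ-< x0 (eastHeight⇒<countE U i ehu) ,
  ≤-trans <hu (+-monoʳ-≤ y0 (eastHeight≤countN U i ehu))

-- The bottom-left and the top-right cell of a polyomino of size m are at taxicab distance m ∸ 1.
size<width+height : ∀ {m S x y width height} → IsParallelogramPolyomino m S →
  (∀ z → z ∈ S → InRectangle x y width height z) → m < width + height
size<width+height {m} {x = x} {y} {width} {height} (contour (x0 , y0) U L , pc , sz , _ , sup) ⊆rect
  with lastSteps pc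
... | U₁ , L₁ , refl , refl
  with ⊆rect _ (sup _ (bottomLeft∈interior pc)) | ⊆rect _ (sup _ (topRight∈interior pc))
... | x≤ , y≤ , _ , _ | _ , _ , right< , top< = +-cancelʳ-≤ (x + y) (suc m) (width + height) (begin
  suc m + (x + y)                               ≤⟨ +-monoʳ-≤ (suc m) (+-mono-≤ x≤ y≤) ⟩
  suc m + (x0 + y0)                             ≡⟨ cong (λ k → suc k + (x0 + y0)) (sym size≡) ⟩
  suc (countE U₁ + suc (countN L₁) + (x0 + y0)) ≡⟨ rearrange (countE U₁) (countN L₁) x0 y0 ⟩
  suc (x0 + countE U₁) + suc (y0 + countN L₁)   ≤⟨ +-mono-≤ right< top< ⟩
  x + width + (y + height)                      ≡⟨ rearrange′ x y width height ⟩
  width + height + (x + y)                      ∎)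
  where
  open ≤-Reasoning
  size≡ : countE U₁ + suc (countN L₁) ≡ m
  size≡ = trans (cong (countE U₁ +_) (sym (countN-corner pc))) (trans (sym (contourSize-∷ʳE (x0 , y0) U₁ (L₁ ∷ʳ N))) sz)
  rearrange : ∀ a b p q → suc (a + suc b + (p + q)) ≡ suc (p + a) + suc (q + b)
  rearrange = solve-∀
  rearrange′ : ∀ p q a b → p + a + (q + b) ≡ a + b + (p + q)
  rearrange′ = solve-∀

IsInteriorOf : Contour → List Cell → Set
IsInteriorOf c R = (∀ z → z ∈ R → InInterior c z) × (∀ z → InInterior c z → z ∈ R)

module _ (f : Cell → ℕ) where

  foldr-⊔-lub : ∀ R {M} → (∀ z → z ∈ R → f z ≤ M) → foldr _⊔_ 0 (map f R) ≤ M
  foldr-⊔-lub []      _  = z≤n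
  foldr-⊔-lub (z ∷ R) ≤M = ⊔-lub (≤M z (here refl)) (foldr-⊔-lub R (λ z′ z′∈ → ≤M z′ (there z′∈)))

  foldr-⊔-ub : ∀ R {z} → z ∈ R → f z ≤ foldr _⊔_ 0 (map f R)
  foldr-⊔-ub (z ∷ R) (here refl) = m≤m⊔n _ _
  foldr-⊔-ub (z ∷ R) (there z∈)  = ≤-trans (foldr-⊔-ub R z∈) (m≤n⊔m (f z) _)

  foldr-⊔-≡-greatest : ∀ R {M z} → (∀ z → z ∈ R → f z ≤ M) → z ∈ R → f z ≡ M → foldr _⊔_ 0 (map f R) ≡ M
  foldr-⊔-≡-greatest R ≤M z∈ refl = ≤-antisym (foldr-⊔-lub R ≤M) (foldr-⊔-ub R z∈)

module _ {x0 y0 U₁ L₁ R} (pc : IsPPContour (contour (x0 , y0) (U₁ ∷ʳ E) (L₁ ∷ʳ N)))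
         (int : IsInteriorOf (contour (x0 , y0) (U₁ ∷ʳ E) (L₁ ∷ʳ N)) R) where

  maxY-corner : maxY R ≡ y0 + countN L₁
  maxY-corner = foldr-⊔-≡-greatest proj₂ R ≤top (proj₂ int _ (topRight∈interior pc)) refl
    where
    ≤top : ∀ z → z ∈ R → proj₂ z ≤ y0 + countN L₁
    ≤top z z∈ with interior⊆rectangle (U₁ ∷ʳ E) (L₁ ∷ʳ N) z (proj₁ int z z∈)
    ... | _ , _ , _ , <top = m<1+n⇒m≤n (subst (proj₂ z <_)
          (trans (cong (y0 +_) (trans (countN-∷ʳE U₁) (countN-corner pc))) (+-suc y0 _)) <top)

  maxX-corner : maxX R ≡ x0 + countE U₁
  maxX-corner = foldr-⊔-≡-greatest proj₁ R ≤right (proj₂ int _ (topRight∈interior pc)) refl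
    where
    ≤right : ∀ z → z ∈ R → proj₁ z ≤ x0 + countE U₁
    ≤right z z∈ with interior⊆rectangle (U₁ ∷ʳ E) (L₁ ∷ʳ N) z (proj₁ int z z∈)
    ... | _ , _ , <right , _ = m<1+n⇒m≤n (subst (proj₁ z <_)
          (trans (cong (x0 +_) (countE-∷ʳE U₁)) (+-suc x0 _)) <right)

∈-deleteTopRow⁺ : ∀ R {z} → z ∈ R → proj₂ z ≢ maxY R → z ∈ deleteTopRow R
∈-deleteTopRow⁺ R = ∈-filter⁺ (λ z → ¬? (proj₂ z ≟ maxY R))

∈-deleteTopRow⁻ : ∀ R {z} → z ∈ deleteTopRow R → z ∈ R × proj₂ z ≢ maxY R
∈-deleteTopRow⁻ R = ∈-filter⁻ (λ z → ¬? (proj₂ z ≟ maxY R))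

∈-deleteRightColumn⁺ : ∀ R {z} → z ∈ R → proj₁ z ≢ maxX R → z ∈ deleteRightColumn R
∈-deleteRightColumn⁺ R = ∈-filter⁺ (λ z → ¬? (proj₁ z ≟ maxX R))

∈-deleteRightColumn⁻ : ∀ R {z} → z ∈ deleteRightColumn R → z ∈ R × proj₁ z ≢ maxX R
∈-deleteRightColumn⁻ R = ∈-filter⁻ (λ z → ¬? (proj₁ z ≟ maxX R))

Snake-filter : ∀ {P : Cell → Set} (P? : ∀ z → Dec (P z)) {R} → Snake R → Snake (filter P? R)
Snake-filter P? snake x y (a , b , c , d) =
  snake x y (proj₁ (∈-filter⁻ P? a) , proj₁ (∈-filter⁻ P? b) , proj₁ (∈-filter⁻ P? c) , proj₁ (∈-filter⁻ P? d))

-- The two paths meet at the common end of U₂ and L₂, which must therefore be the start.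
cornerNE-EN-size≡1 : ∀ {x0 y0 U₂ L₂} → IsPPContour (contour (x0 , y0) (U₂ ∷ʳ N ∷ʳ E) (L₂ ∷ʳ E ∷ʳ N)) →
  contourSize (contour (x0 , y0) (U₂ ∷ʳ N ∷ʳ E) (L₂ ∷ʳ E ∷ʳ N)) ≡ 1
cornerNE-EN-size≡1 {x0} {y0} {U₂} {L₂} pc
  with meetOnlyEnds pc (pathEnd (x0 , y0) U₂)
         (vertices-++⁺ _ (U₂ ∷ʳ N) (E ∷ []) (vertices-++⁺ _ U₂ (N ∷ []) (pathEnd∈vertices x0 y0 U₂)))
         (∈-resp-≡ (pathEnd-cong (x0 , y0) L₂ U₂ (sym eE) (sym eN))
            (vertices-++⁺ _ (L₂ ∷ʳ E) (N ∷ []) (vertices-++⁺ _ L₂ (E ∷ []) (pathEnd∈vertices x0 y0 L₂))))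
  where
  eE : countE U₂ ≡ countE L₂
  eE = sym (suc-injective (trans (sym (countE-∷ʳE L₂)) (trans (countE-corner pc) (cong suc (countE-∷ʳN U₂)))))
  eN : countN U₂ ≡ countN L₂
  eN = suc-injective (trans (sym (countN-∷ʳN U₂)) (trans (countN-corner pc) (cong suc (countN-∷ʳE L₂))))
... | inj₂ e = ⊥-elim (1+n≢n (sym (+-cancelˡ-≡ x0 _ _ (trans (cong proj₁ e)
                 (cong (x0 +_) (trans (countE-∷ʳE (U₂ ∷ʳ N)) (cong suc (countE-∷ʳN U₂))))))))
... | inj₁ e = begin
  contourSize (contour (x0 , y0) (U₂ ∷ʳ N ∷ʳ E) (L₂ ∷ʳ E ∷ʳ N)) ≡⟨ contourSize-∷ʳE (x0 , y0) (U₂ ∷ʳ N) (L₂ ∷ʳ E ∷ʳ N) ⟩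
  countE (U₂ ∷ʳ N) + countN (U₂ ∷ʳ N)                          ≡⟨ cong₂ _+_ (countE-∷ʳN U₂) (countN-∷ʳN U₂) ⟩
  countE U₂ + suc (countN U₂)                                  ≡⟨ cong₂ (λ a b → a + suc b) noEast noNorth ⟩
  1                                                            ∎
  where
  open ≡-Reasoning
  noEast : countE U₂ ≡ 0
  noEast = +-cancelˡ-≡ x0 _ _ (trans (cong proj₁ e) (sym (+-identityʳ x0)))
  noNorth : countN U₂ ≡ 0
  noNorth = +-cancelˡ-≡ y0 _ _ (trans (cong proj₂ e) (sym (+-identityʳ y0)))

-- The last two columns both end at the top height and start at most two below it.
cornerEE-NN⇒¬Snake : ∀ {x0 y0 U₂ L₂ R} → IsPPContour (contour (x0 , y0) (U₂ ∷ʳ E ∷ʳ E) (L₂ ∷ʳ N ∷ʳ N)) →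
  (∀ z → InInterior (contour (x0 , y0) (U₂ ∷ʳ E ∷ʳ E) (L₂ ∷ʳ N ∷ʳ N)) z → z ∈ R) → ¬ Snake R
cornerEE-NN⇒¬Snake {x0} {y0} {U₂} {L₂} {R} pc ⊆R snake =
  snake (x0 + i₀) (y0 + countN L₂)
    ( inColumn i₀ top₀ (m<n⇒m<1+n (n<1+n _)) (countN L₂) ≤-refl (n≤1+n _)
    , shift (inColumn (suc i₀) top₁ (n<1+n _) (countN L₂) ≤-refl (n≤1+n _))
    , ∈-resp-≡ (cong (x0 + i₀ ,_) (+-suc y0 _)) (inColumn i₀ top₀ (m<n⇒m<1+n (n<1+n _)) (suc (countN L₂)) (n≤1+n _) ≤-refl)
    , shift (∈-resp-≡ (cong (x0 + suc i₀ ,_) (+-suc y0 _)) (inColumn (suc i₀) top₁ (n<1+n _) (suc (countN L₂)) (n≤1+n _) ≤-refl)) )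
  where
  U₁ U L : List Step
  U₁ = U₂ ∷ʳ E
  U  = U₁ ∷ʳ E
  L  = L₂ ∷ʳ N ∷ʳ N
  i₀ : ℕ
  i₀ = countE U₂
  top : countN U₂ ≡ suc (suc (countN L₂))
  top = trans (sym (countN-∷ʳE U₂)) (trans (countN-corner pc) (cong suc (countN-∷ʳN L₂)))
  lowerColumns : countE L₂ ≡ suc (suc i₀)
  lowerColumns = trans (sym (countE-∷ʳN L₂)) (trans (countE-corner pc) (cong suc (countE-∷ʳE U₂)))
  top₀ : nth (eastHeights U) i₀ ≡ just (countN U₂)
  top₀ = nth-resp i₀ (sym (eastHeights-∷ʳE U₁)) (nth-∷ʳ⁺ (eastHeights U₁) i₀ (eastHeight-last U₂))
  top₁ : nth (eastHeights U) (suc i₀) ≡ just (countN U₂)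
  top₁ = subst₂ (λ i h → nth (eastHeights U) i ≡ just h) (countE-∷ʳE U₂) (countN-∷ʳE U₂) (eastHeight-last U₁)
  inColumn : ∀ i → nth (eastHeights U) i ≡ just (countN U₂) → i < suc (suc i₀) →
             ∀ t → countN L₂ ≤ t → t ≤ suc (countN L₂) → (x0 + i , y0 + t) ∈ R
  inColumn i upper i<columns t ≥bottom ≤top with <countE⇒eastHeight L₂ i (subst (i <_) (sym lowerColumns) i<columns)
  ... | hl , lower , hl≤ = ⊆R _
        ( i , hl , countN U₂ , refl , nth-resp i (sym (trans (eastHeights-∷ʳN (L₂ ∷ʳ N)) (eastHeights-∷ʳN L₂))) lower
        , upper , +-monoʳ-≤ y0 (≤-trans hl≤ ≥bottom) , +-monoʳ-< y0 (subst (t <_) (sym top) (s≤s ≤top)) )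
  shift : ∀ {y} → (x0 + suc i₀ , y) ∈ R → (suc (x0 + i₀) , y) ∈ R
  shift {y} = ∈-resp-≡ (cong (_, y) (+-suc x0 i₀))

module CornerNE-NN {m : ℕ} {R : List Cell} {x0 y0 : ℕ} {U₂ L₂ : List Step}
  (pc  : IsPPContour (contour (x0 , y0) (U₂ ∷ʳ N ∷ʳ E) (L₂ ∷ʳ N ∷ʳ N)))
  (sz  : contourSize (contour (x0 , y0) (U₂ ∷ʳ N ∷ʳ E) (L₂ ∷ʳ N ∷ʳ N)) ≡ suc (suc m))
  (int : IsInteriorOf (contour (x0 , y0) (U₂ ∷ʳ N ∷ʳ E) (L₂ ∷ʳ N ∷ʳ N)) R) where

  private
    U L : List Step
    U = U₂ ∷ʳ N ∷ʳ E
    L = L₂ ∷ʳ N ∷ʳ N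

    columns : countE L₂ ≡ suc (countE U₂)
    columns = trans (sym (countE-∷ʳN L₂)) (trans (countE-corner pc) (cong suc (countE-∷ʳN U₂)))

    top : countN U₂ ≡ suc (countN L₂)
    top = suc-injective (trans (sym (countN-∷ʳN U₂)) (trans (countN-corner pc) (cong suc (countN-∷ʳN L₂))))

    size≡ : countE U₂ + countN U₂ ≡ suc m
    size≡ = suc-injective (begin
      suc (countE U₂ + countN U₂)         ≡⟨ sym (+-suc (countE U₂) (countN U₂)) ⟩
      countE U₂ + suc (countN U₂)         ≡⟨ sym (cong₂ _+_ (countE-∷ʳN U₂) (countN-∷ʳN U₂)) ⟩
      countE (U₂ ∷ʳ N) + countN (U₂ ∷ʳ N) ≡⟨ sym (contourSize-∷ʳE (x0 , y0) (U₂ ∷ʳ N) L) ⟩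
      contourSize (contour (x0 , y0) U L) ≡⟨ sz ⟩
      suc (suc m)                         ∎)
      where open ≡-Reasoning

    maxY≡ : maxY R ≡ y0 + countN U₂
    maxY≡ = trans (maxY-corner pc int) (cong (y0 +_) (trans (countN-∷ʳN L₂) (sym top)))

    maxX≡ : maxX R ≡ x0 + countE U₂
    maxX≡ = trans (maxX-corner pc int) (cong (x0 +_) (countE-∷ʳN U₂))

    upperHeights : eastHeights U ≡ eastHeights U₂ ∷ʳ suc (countN U₂)
    upperHeights = trans (eastHeights-∷ʳE (U₂ ∷ʳ N)) (cong₂ _∷ʳ_ (eastHeights-∷ʳN U₂) (countN-∷ʳN U₂))

    lowerHeights : eastHeights (L₂ ∷ʳ N) ≡ eastHeights L
    lowerHeights = sym (eastHeights-∷ʳN (L₂ ∷ʳ N))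

    rest : Contour
    rest = contour (x0 , y0) (U₂ ∷ʳ E) (L₂ ∷ʳ N)

    rest-meetOnlyEnds : ∀ p → p ∈ vertices (x0 , y0) (U₂ ∷ʳ E) → p ∈ vertices (x0 , y0) (L₂ ∷ʳ N) →
                        p ≡ (x0 , y0) ⊎ p ≡ endPoint rest
    rest-meetOnlyEnds p p∈U′ p∈L′ with vertices-∷ʳ⁻ (x0 , y0) U₂ E p∈U′
    ... | inj₂ e = inj₂ e
    ... | inj₁ p∈U₂ with meetOnlyEnds pc p (vertices-++⁺ _ (U₂ ∷ʳ N) (E ∷ []) (vertices-++⁺ _ U₂ (N ∷ []) p∈U₂))
                           (vertices-++⁺ _ (L₂ ∷ʳ N) (N ∷ []) p∈L′)
    ...   | inj₁ e = inj₁ e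
    ...   | inj₂ e = ⊥-elim (<⇒≱ (subst (y0 + countN (L₂ ∷ʳ N) <_) (sym (cong proj₂ e)) aboveL′)
                                  (proj₂ (vertices-bounded x0 y0 (L₂ ∷ʳ N) p∈L′)))
      where
      aboveL′ : y0 + countN (L₂ ∷ʳ N) < y0 + countN U
      aboveL′ = +-monoʳ-< y0 (subst (countN (L₂ ∷ʳ N) <_) (sym (trans (sameN pc) (countN-∷ʳN (L₂ ∷ʳ N)))) (n<1+n _))

    rest-isPPContour : IsPPContour rest
    rest-isPPContour = record
      { upperStartsN = StartsWith-replaceLast U₂ (countN≡suc⇒≢[] top) (StartsWith-dropLast U₂ (upperStartsN pc))
      ; lowerStartsE = StartsWith-dropLast L₂ (lowerStartsE pc)
      ; sameE        = trans (countE-∷ʳE U₂) (trans (sym columns) (sym (countE-∷ʳN L₂)))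
      ; sameN        = trans (countN-∷ʳE U₂) (trans top (sym (countN-∷ʳN L₂)))
      ; meetOnlyEnds = rest-meetOnlyEnds
      }

    interior-rest⊆ : ∀ z → InInterior rest z → z ∈ deleteTopRow R
    interior-rest⊆ (x , y) (i , hl , hu , ex , ehl , ehu , hl≤ , <hu)
      with nth-∷ʳ⁻ (eastHeights U₂) i (nth-resp i (eastHeights-∷ʳE U₂) ehu)
    ... | inj₁ eu = ∈-deleteTopRow⁺ R (proj₂ int _ old) (λ e → <⇒≢ (≤-trans <hu (+-monoʳ-≤ y0 hu≤)) (trans e maxY≡))
      where
      hu≤ : hu ≤ countN U₂
      hu≤ = eastHeight≤countN U₂ i eu
      old : InInterior (contour (x0 , y0) U L) (x , y)
      old = i , hl , hu , ex , nth-resp i lowerHeights ehl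
          , nth-resp i (sym upperHeights) (nth-∷ʳ⁺ (eastHeights U₂) i eu) , hl≤ , <hu
    ... | inj₂ (refl , refl) = ∈-deleteTopRow⁺ R (proj₂ int _ old) (λ e → <⇒≢ <hu (trans e maxY≡))
      where
      old : InInterior (contour (x0 , y0) U L) (x , y)
      old = i , hl , suc (countN U₂) , ex , nth-resp i lowerHeights ehl
          , nth-resp i (sym upperHeights) (nth-∷ʳ-length (eastHeights U₂) (suc (countN U₂)))
          , hl≤ , ≤-trans <hu (+-monoʳ-≤ y0 (n≤1+n _))

    ⊆interior-rest : ∀ z → z ∈ deleteTopRow R → InInterior rest z
    ⊆interior-rest (x , y) z∈ with ∈-deleteTopRow⁻ R z∈
    ... | z∈R , y≢top with proj₁ int _ z∈R
    ... | i , hl , hu , ex , ehl , ehu , hl≤ , <hu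
      with nth-∷ʳ⁻ (eastHeights U₂) i (nth-resp i upperHeights ehu)
    ... | inj₁ eu = i , hl , hu , ex , nth-resp i (sym lowerHeights) ehl
                  , nth-resp i (sym (eastHeights-∷ʳE U₂)) (nth-∷ʳ⁺ (eastHeights U₂) i eu) , hl≤ , <hu
    ... | inj₂ (refl , refl) = i , hl , countN U₂ , ex , nth-resp i (sym lowerHeights) ehl
                  , nth-resp i (sym (eastHeights-∷ʳE U₂)) (nth-∷ʳ-length (eastHeights U₂) (countN U₂))
                  , hl≤ , <+suc∧≢⇒< y0 (countN U₂) <hu (λ e → y≢top (trans e (sym maxY≡)))

  deleteTopRow-polyomino : IsParallelogramPolyomino (suc m) (deleteTopRow R)
  deleteTopRow-polyomino =
    rest , rest-isPPContour , trans (contourSize-∷ʳE (x0 , y0) U₂ (L₂ ∷ʳ N)) size≡ , ⊆interior-rest , interior-rest⊆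

  -- The top row is the single top-right cell, so deleting the right column also deletes the top row.
  deleteRightColumn-notPolyomino : ¬ IsParallelogramPolyomino (suc m) (deleteRightColumn R)
  deleteRightColumn-notPolyomino pp = <-irrefl (sym size≡) (size<width+height pp inRectangle)
    where
    inRectangle : ∀ z → z ∈ deleteRightColumn R → InRectangle x0 y0 (countE U₂) (countN U₂) z
    inRectangle (x , y) z∈ with ∈-deleteRightColumn⁻ R z∈
    ... | z∈R , x≢right with proj₁ int _ z∈R | interior⊆rectangle U L _ (proj₁ int _ z∈R)
    ... | i , hl , hu , ex , ehl , ehu , hl≤ , <hu | x0≤ , y0≤ , _ , _
      with nth-∷ʳ⁻ (eastHeights U₂) i (nth-resp i upperHeights ehu)
    ... | inj₂ (refl , _) = ⊥-elim (x≢right (trans ex (trans (cong (x0 +_) (length-eastHeights U₂)) (sym maxX≡))))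
    ... | inj₁ eu = x0≤ , y0≤ , subst (_< x0 + countE U₂) (sym ex) (+-monoʳ-< x0 (eastHeight⇒<countE U₂ i eu))
                  , ≤-trans <hu (+-monoʳ-≤ y0 (eastHeight≤countN U₂ i eu))

module CornerEE-EN {m : ℕ} {R : List Cell} {x0 y0 : ℕ} {U₂ L₂ : List Step}
  (pc  : IsPPContour (contour (x0 , y0) (U₂ ∷ʳ E ∷ʳ E) (L₂ ∷ʳ E ∷ʳ N)))
  (sz  : contourSize (contour (x0 , y0) (U₂ ∷ʳ E ∷ʳ E) (L₂ ∷ʳ E ∷ʳ N)) ≡ suc (suc m))
  (int : IsInteriorOf (contour (x0 , y0) (U₂ ∷ʳ E ∷ʳ E) (L₂ ∷ʳ E ∷ʳ N)) R) where

  private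
    U₁ U L : List Step
    U₁ = U₂ ∷ʳ E
    U  = U₁ ∷ʳ E
    L  = L₂ ∷ʳ E ∷ʳ N

    columns : countE L₂ ≡ countE U₁
    columns = suc-injective (trans (sym (countE-∷ʳE L₂)) (countE-corner pc))

    top : countN U₁ ≡ suc (countN L₂)
    top = trans (countN-corner pc) (cong suc (countN-∷ʳE L₂))

    size≡ : countE U₂ + countN U₂ ≡ suc m
    size≡ = suc-injective (begin
      suc (countE U₂ + countN U₂)         ≡⟨ sym (cong₂ _+_ (countE-∷ʳE U₂) (countN-∷ʳE U₂)) ⟩
      countE U₁ + countN U₁               ≡⟨ sym (contourSize-∷ʳE (x0 , y0) U₁ L) ⟩
      contourSize (contour (x0 , y0) U L) ≡⟨ sz ⟩
      suc (suc m)                         ∎)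
      where open ≡-Reasoning

    width+height≡ : countE U₁ + countN L₂ ≡ suc m
    width+height≡ = begin
      countE U₁ + countN L₂       ≡⟨ cong (_+ countN L₂) (countE-∷ʳE U₂) ⟩
      suc (countE U₂ + countN L₂) ≡⟨ sym (+-suc (countE U₂) (countN L₂)) ⟩
      countE U₂ + suc (countN L₂) ≡⟨ cong (countE U₂ +_) (trans (sym top) (countN-∷ʳE U₂)) ⟩
      countE U₂ + countN U₂       ≡⟨ size≡ ⟩
      suc m                       ∎
      where open ≡-Reasoning

    maxY≡ : maxY R ≡ y0 + countN L₂
    maxY≡ = trans (maxY-corner pc int) (cong (y0 +_) (countN-∷ʳE L₂))

    maxX≡ : maxX R ≡ x0 + countE U₁
    maxX≡ = maxX-corner pc int

    upperHeights : eastHeights U ≡ eastHeights U₁ ∷ʳ countN U₁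
    upperHeights = eastHeights-∷ʳE U₁

    lowerHeights : eastHeights L ≡ eastHeights L₂ ∷ʳ countN L₂
    lowerHeights = trans (eastHeights-∷ʳN (L₂ ∷ʳ E)) (eastHeights-∷ʳE L₂)

    rest : Contour
    rest = contour (x0 , y0) U₁ (L₂ ∷ʳ N)

    rest-meetOnlyEnds : ∀ p → p ∈ vertices (x0 , y0) U₁ → p ∈ vertices (x0 , y0) (L₂ ∷ʳ N) →
                        p ≡ (x0 , y0) ⊎ p ≡ endPoint rest
    rest-meetOnlyEnds p p∈U₁ p∈L′ with vertices-∷ʳ⁻ (x0 , y0) L₂ N p∈L′
    ... | inj₂ e = inj₂ (trans e (pathEnd-cong (x0 , y0) (L₂ ∷ʳ N) U₁
                          (trans (countE-∷ʳN L₂) columns) (trans (countN-∷ʳN L₂) (sym top))))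
    ... | inj₁ p∈L₂ with meetOnlyEnds pc p (vertices-++⁺ _ U₁ (E ∷ []) p∈U₁)
                           (vertices-++⁺ _ (L₂ ∷ʳ E) (N ∷ []) (vertices-++⁺ _ L₂ (E ∷ []) p∈L₂))
    ...   | inj₁ e = inj₁ e
    ...   | inj₂ e = ⊥-elim (<⇒≱ (subst (x0 + countE L₂ <_) (sym (cong proj₁ e)) rightOfL₂)
                                  (proj₁ (vertices-bounded x0 y0 L₂ p∈L₂)))
      where
      rightOfL₂ : x0 + countE L₂ < x0 + countE U
      rightOfL₂ = +-monoʳ-< x0 (subst (countE L₂ <_) (sym (trans (countE-∷ʳE U₁) (cong suc (sym columns)))) (n<1+n _))

    rest-isPPContour : IsPPContour rest
    rest-isPPContour = record
      { upperStartsN = StartsWith-dropLast U₂ (upperStartsN pc)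
      ; lowerStartsE = StartsWith-replaceLast L₂ (countE≡suc⇒≢[] (trans columns (countE-∷ʳE U₂)))
                         (StartsWith-dropLast L₂ (lowerStartsE pc))
      ; sameE        = trans (sym columns) (sym (countE-∷ʳN L₂))
      ; sameN        = trans top (sym (countN-∷ʳN L₂))
      ; meetOnlyEnds = rest-meetOnlyEnds
      }

    interior-rest⊆ : ∀ z → InInterior rest z → z ∈ deleteRightColumn R
    interior-rest⊆ (x , y) (i , hl , hu , ex , ehl , ehu , hl≤ , <hu) =
      ∈-deleteRightColumn⁺ R (proj₂ int _ old) (λ e → <⇒≢ <right (trans e maxX≡))
      where
      <right : x < x0 + countE U₁
      <right = subst (_< x0 + countE U₁) (sym ex) (+-monoʳ-< x0 (eastHeight⇒<countE U₁ i ehu))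
      old : InInterior (contour (x0 , y0) U L) (x , y)
      old = i , hl , hu , ex
          , nth-resp i (sym lowerHeights) (nth-∷ʳ⁺ (eastHeights L₂) i (nth-resp i (eastHeights-∷ʳN L₂) ehl))
          , nth-resp i (sym upperHeights) (nth-∷ʳ⁺ (eastHeights U₁) i ehu) , hl≤ , <hu

    belowTop : ∀ {y} → y < y0 + countN U → y ≢ maxY R → y < y0 + countN L₂
    belowTop {y} <top y≢top = <+suc∧≢⇒< y0 (countN L₂)
      (subst (λ k → y < y0 + k) (trans (countN-∷ʳE U₁) top) <top) (λ e → y≢top (trans e (sym maxY≡)))

    notRightColumn : ∀ {x i} → x ≡ x0 + i → x ≢ maxX R → i ≢ countE U₁
    notRightColumn ex x≢right e = x≢right (trans ex (trans (cong (x0 +_) e) (sym maxX≡)))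

    ⊆interior-rest : ∀ z → z ∈ deleteRightColumn R → InInterior rest z
    ⊆interior-rest (x , y) z∈ with ∈-deleteRightColumn⁻ R z∈
    ... | z∈R , x≢right with proj₁ int _ z∈R
    ... | i , hl , hu , ex , ehl , ehu , hl≤ , <hu
      with nth-∷ʳ⁻ (eastHeights U₁) i (nth-resp i upperHeights ehu)
         | nth-∷ʳ⁻ (eastHeights L₂) i (nth-resp i lowerHeights ehl)
    ... | inj₂ (e , _) | _ = ⊥-elim (notRightColumn ex x≢right (trans e (length-eastHeights U₁)))
    ... | _ | inj₂ (e , _) = ⊥-elim (notRightColumn ex x≢right (trans e (trans (length-eastHeights L₂) columns)))
    ... | inj₁ eu | inj₁ el = i , hl , hu , ex , nth-resp i (sym (eastHeights-∷ʳN L₂)) el , eu , hl≤ , <hu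

  deleteRightColumn-polyomino : IsParallelogramPolyomino (suc m) (deleteRightColumn R)
  deleteRightColumn-polyomino =
    rest , rest-isPPContour , trans (contourSize-∷ʳE (x0 , y0) U₂ (L₂ ∷ʳ N)) size≡ , ⊆interior-rest , interior-rest⊆

  -- The right column is the single top-right cell, so deleting the top row also deletes the right column.
  deleteTopRow-notPolyomino : ¬ IsParallelogramPolyomino (suc m) (deleteTopRow R)
  deleteTopRow-notPolyomino pp = <-irrefl (sym width+height≡) (size<width+height pp inRectangle)
    where
    inRectangle : ∀ z → z ∈ deleteTopRow R → InRectangle x0 y0 (countE U₁) (countN L₂) z
    inRectangle (x , y) z∈ with ∈-deleteTopRow⁻ R z∈
    ... | z∈R , y≢top with proj₁ int _ z∈R | interior⊆rectangle U L _ (proj₁ int _ z∈R)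
    ... | i , hl , hu , ex , ehl , ehu , hl≤ , <hu | x0≤ , y0≤ , _ , <top
      with nth-∷ʳ⁻ (eastHeights L₂) i (nth-resp i lowerHeights ehl)
    ... | inj₂ (_ , refl) = ⊥-elim (<⇒≱ (belowTop <top y≢top) hl≤)
    ... | inj₁ el = x0≤ , y0≤
                  , subst (_< x0 + countE U₁) (sym ex) (+-monoʳ-< x0 (subst (i <_) columns (eastHeight⇒<countE L₂ i el)))
                  , belowTop <top y≢top

UniqueSlicing : ℕ → List Cell → Set
UniqueSlicing n R = Σ (List (List Cell)) λ bs → BaxterSlicing n R bs × (∀ bs′ → BaxterSlicing n R bs′ → bs′ ≡ bs)

slicing⇒polyomino : ∀ {n S bs} → BaxterSlicing n S bs → IsParallelogramPolyomino n S
slicing⇒polyomino (single _ pp)       = pp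
slicing⇒polyomino (horiz _ _ _ pp _) = pp
slicing⇒polyomino (vert _ _ _ pp _)  = pp

polyomino-size≢0 : ∀ {R} → ¬ IsParallelogramPolyomino 0 R
polyomino-size≢0 (_ , pc , sz , _) =
  <⇒≱ (+-mono-≤ (subst (0 <_) (sym (sameE pc)) (StartsWith⇒countE>0 (lowerStartsE pc))) (StartsWith⇒countN>0 (upperStartsN pc)))
      (m∸n≡0⇒m≤n sz)

uniqueSlicing-cell : ∀ {R} → IsParallelogramPolyomino 1 R → UniqueSlicing 1 R
uniqueSlicing-cell {R} pp = R ∷ [] , single R pp , unique
  where
  unique : ∀ bs′ → BaxterSlicing 1 R bs′ → bs′ ≡ R ∷ []
  unique _ (single _ _)     = refl
  unique _ (horiz _ _ _ _ ())
  unique _ (vert _ _ _ _ ())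

uniqueSlicing-topRow : ∀ {n R} → IsParallelogramPolyomino (suc n) R → ¬ IsParallelogramPolyomino n (deleteRightColumn R) →
                       UniqueSlicing n (deleteTopRow R) → UniqueSlicing (suc n) R
uniqueSlicing-topRow {n} {R} pp ¬right (bs , sl , unique) = topRow R ∷ bs , horiz n R bs pp sl , unique′
  where
  unique′ : ∀ bs′ → BaxterSlicing (suc n) R bs′ → bs′ ≡ topRow R ∷ bs
  unique′ _ (single _ _)          = ⊥-elim (polyomino-size≢0 (slicing⇒polyomino sl))
  unique′ _ (horiz _ _ bs″ _ sl′) = cong (topRow R ∷_) (unique bs″ sl′)
  unique′ _ (vert _ _ _ _ sl′)    = ⊥-elim (¬right (slicing⇒polyomino sl′))

uniqueSlicing-rightColumn : ∀ {n R} → IsParallelogramPolyomino (suc n) R → ¬ IsParallelogramPolyomino n (deleteTopRow R) →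
                            UniqueSlicing n (deleteRightColumn R) → UniqueSlicing (suc n) R
uniqueSlicing-rightColumn {n} {R} pp ¬top (bs , sl , unique) = rightColumn R ∷ bs , vert n R bs pp sl , unique′
  where
  unique′ : ∀ bs′ → BaxterSlicing (suc n) R bs′ → bs′ ≡ rightColumn R ∷ bs
  unique′ _ (single _ _)         = ⊥-elim (polyomino-size≢0 (slicing⇒polyomino sl))
  unique′ _ (horiz _ _ _ _ sl′)  = ⊥-elim (¬top (slicing⇒polyomino sl′))
  unique′ _ (vert _ _ bs″ _ sl′) = cong (rightColumn R ∷_) (unique bs″ sl′)

ExactlyOneDeletion : ℕ → List Cell → Set
ExactlyOneDeletion n R =
    (IsParallelogramPolyomino n (deleteTopRow R) × ¬ IsParallelogramPolyomino n (deleteRightColumn R))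
  ⊎ (IsParallelogramPolyomino n (deleteRightColumn R) × ¬ IsParallelogramPolyomino n (deleteTopRow R))

uniqueSlicing-byDeletion : ∀ {n R} → IsParallelogramPolyomino (suc n) R → ExactlyOneDeletion n R →
  (IsParallelogramPolyomino n (deleteTopRow R) → UniqueSlicing n (deleteTopRow R)) →
  (IsParallelogramPolyomino n (deleteRightColumn R) → UniqueSlicing n (deleteRightColumn R)) →
  UniqueSlicing (suc n) R
uniqueSlicing-byDeletion pp (inj₁ (top , ¬right)) slice _ = uniqueSlicing-topRow pp ¬right (slice top)
uniqueSlicing-byDeletion pp (inj₂ (right , ¬top)) _ slice = uniqueSlicing-rightColumn pp ¬top (slice right)

snake-exactlyOneDeletion : ∀ {m R} → IsParallelogramPolyomino (suc (suc m)) R → Snake R → ExactlyOneDeletion (suc m) R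
snake-exactlyOneDeletion (contour (_ , _) _ _ , pc , _) _ with lastSteps pc
... | U₁ , L₁ , refl , refl with reverseView U₁ | reverseView L₁
... | [] | _ with upperStartsN pc
...   | _ , ()
snake-exactlyOneDeletion (_ , pc , _) _ | _ , _ , refl , refl | _ | [] with lowerStartsE pc
...   | _ , ()
snake-exactlyOneDeletion (_ , pc , sz , _) _ | _ , _ , refl , refl | _ ∶ _ ∶ʳ N | _ ∶ _ ∶ʳ E =
  ⊥-elim (1+n≢0 (suc-injective (trans (sym sz) (cornerNE-EN-size≡1 pc))))
snake-exactlyOneDeletion (_ , pc , _ , int) snake | _ , _ , refl , refl | _ ∶ _ ∶ʳ E | _ ∶ _ ∶ʳ N =
  ⊥-elim (cornerEE-NN⇒¬Snake pc (proj₂ int) snake)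
snake-exactlyOneDeletion (_ , pc , sz , int) _ | _ , _ , refl , refl | _ ∶ _ ∶ʳ N | _ ∶ _ ∶ʳ N =
  inj₁ (CornerNE-NN.deleteTopRow-polyomino pc sz int , CornerNE-NN.deleteRightColumn-notPolyomino pc sz int)
snake-exactlyOneDeletion (_ , pc , sz , int) _ | _ , _ , refl , refl | _ ∶ _ ∶ʳ E | _ ∶ _ ∶ʳ E =
  inj₂ (CornerEE-EN.deleteRightColumn-polyomino pc sz int , CornerEE-EN.deleteTopRow-notPolyomino pc sz int)

mainTheorem4 : (n : ℕ) (R : List Cell) → IsParallelogramPolyomino n R → Snake R →
    Σ (List (List Cell)) (λ bs → BaxterSlicing n R bs × (∀ bs′ → BaxterSlicing n R bs′ → bs′ ≡ bs))
mainTheorem4 zero          R pp _     = ⊥-elim (polyomino-size≢0 pp)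
mainTheorem4 (suc zero)    R pp _     = uniqueSlicing-cell pp
mainTheorem4 (suc (suc m)) R pp snake =
  uniqueSlicing-byDeletion pp (snake-exactlyOneDeletion pp snake)
    (λ top → mainTheorem4 (suc m) (deleteTopRow R) top (Snake-filter _ snake))
    (λ right → mainTheorem4 (suc m) (deleteRightColumn R) right (Snake-filter _ snake))
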